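{- In the language qPCF described in the context, if $B\vdash M:\kappa$ is derivable then $\mathrm{Comp}(B,M,\kappa)$ holds.
   Context: qPCF is an explicitly typed (Church-style) extension of PCF, parameterized by a set $\mathcal U=\bigcup_{k\ge 0}\mathcal U(k)$ of gate names ($\mathcal U(k)$: gates on $k+1$ qubits) and a total arity-preserving map $\ddagger$ on gates. Types: $\sigma,\tau ::= \mathsf{Nat}\mid \mathsf{Idx}\mid \mathsf{Circ}(E)\mid \Pi x^{\sigma}.\tau$ ($E$ a term); $\sigma\to\tau$ abbreviates $\Pi x^\sigma.\tau$ when $x$ does not matter. Terms: $x\mid \lambda x^\sigma.M\mid MN\mid \underline{n}\ (n\in\mathbb N)\mid \mathtt{pred}\mid\mathtt{succ}\mid \mathtt{if}\mid Y_\sigma\mid \mathtt{set}\mid\mathtt{get}\mid U\ (U\in\mathcal U)\mid {::}\mid \parallel\mid \mathtt{iter}\mid\mathtt{reverse}\mid \odot\,E\,E'\ (\odot\in\{+,*\})\mid \mathtt{size}\mid\mathtt{dMeas}$. Bases $B$: finite sets of declarations $x:\sigma$ with distinct variables. $\mathrm{surf}(B,\mathsf{Nat})=\mathrm{surf}(B,\mathsf{Idx})=\emptyset$, $\mathrm{surf}(B,\mathsf{Circ}(E))=\{B\vdash E:\mathsf{Idx}\}$, $\mathrm{surf}(B,\Pi x^\sigma.\tau)=\mathrm{surf}(B,\sigma)\cup\mathrm{surf}(B\cup\{x:\sigma\},\tau)$ (union over finite sets of types); $\mathrm{WF}(B,S)$ means every typing in $\mathrm{surf}(B,S)$ is derivable.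 Typing rules (types up to the congruence generated by $\alpha$-conversion, $\beta$-convertibility of terms in types, and associativity/commutativity/distributivity/neutral elements of $+,*$): $B\cup\{x:\sigma\}\vdash x:\sigma$ if $\mathrm{WF}(B,\mathrm{codom}(B)\cup\{\sigma\})$; from $B\cup\{x:\sigma\}\vdash N:\tau$ infer $B\vdash\lambda x^\sigma.N:\Pi x^\sigma.\tau$; from $B\vdash P:\Pi x^\sigma.\tau$, $B\vdash Q:\sigma$ infer $B\vdash PQ:\tau[Q/x]$; provided $\mathrm{WF}(B,\mathrm{codom}(B))$: $\mathtt{succ},\mathtt{pred}:\mathsf{Nat}\to\mathsf{Nat}$, $\mathtt{if}:\mathsf{Nat}\to\mathsf{Nat}\to\mathsf{Nat}\to\mathsf{Nat}$, $\mathtt{get},\mathtt{set}:\mathsf{Nat}\to\mathsf{Nat}\to\mathsf{Nat}$, $\underline n:\mathsf{Idx}$, $U:\mathsf{Circ}(\underline k)$ for $U\in\mathcal U(k)$; if $B\vdash E:\mathsf{Idx}$ then $\mathtt{if}:\mathsf{Nat}\to\mathsf{Circ}(E)\to\mathsf{Circ}(E)\to\mathsf{Circ}(E)$; $Y_\sigma:(\sigma\to\sigma)\to\sigma$ if $\sigma=\tau_1\to\dots\to\tau_n\to\gamma$, $n\ge0$, $\gamma$ is $\mathsf{Nat}$ or some $\mathsf{Circ}(E)$, and $\mathrm{WF}(B,\mathrm{codom}(B)\cup\{\sigma\})$; from $B\vdash M:\mathsf{Idx}$ infer $B\vdash M:\mathsf{Nat}$; from $B\vdash E_0,E_1:\mathsf{Idx}$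 infer $B\vdash\odot E_0E_1:\mathsf{Idx}$; from $B\vdash M:\mathsf{Circ}(E)$ infer $B\vdash\mathtt{size}\,M:\mathsf{Idx}$; given $B\vdash E:\mathsf{Idx}$: ${::}:\mathsf{Circ}(E)\to\mathsf{Circ}(E)\to\mathsf{Circ}(E)$, $\mathtt{reverse}:\mathsf{Circ}(E)\to\mathsf{Circ}(E)$, $\mathtt{dMeas}:\mathsf{Nat}\to\mathsf{Circ}(E)\to\mathsf{Nat}$; given $B\vdash E_0,E_1:\mathsf{Idx}$: $\parallel:\mathsf{Circ}(E_0)\to\mathsf{Circ}(E_1)\to\mathsf{Circ}(E_0+E_1+1)$, $\mathtt{iter}:\Pi x^{\mathsf{Idx}}.\mathsf{Circ}(E_0)\to\mathsf{Circ}(E_1)\to\mathsf{Circ}(E_0+((1+E_1)*x))$. Evaluation: judgments $M\Downarrow^{\alpha}V$ ($M$ closed of ground type, $0<\alpha\le1$, $V$ a numeral or a circuit, i.e. a term built from gate names with $::$ and $\parallel$), derived by: $\underline n\Downarrow^1\underline n$; $M\Downarrow^\alpha\underline n\Rightarrow \mathtt{succ}M\Downarrow^\alpha\underline{n+1}$; $M\Downarrow^\alpha\underline{n+1}\Rightarrow\mathtt{pred}M\Downarrow^\alpha\underline n$; $M[N/x]P_1\cdots P_m\Downarrow^\alpha V\Rightarrow(\lambda x.M)NP_1\cdots P_m\Downarrow^\alpha V$; $M\Downarrow^\alpha\underline0, L\Downarrow^{\alpha'}V\Rightarrow\mathtt{if}\,M\,L\,R\Downarrow^{\alpha\alpha'}V$;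 $M\Downarrow^\alpha\underline{n+1},R\Downarrow^{\alpha'}V\Rightarrow\mathtt{if}\,M\,L\,R\Downarrow^{\alpha\alpha'}V$; $M(YM)P_1\cdots P_i\Downarrow^\alpha V\Rightarrow YMP_1\cdots P_i\Downarrow^\alpha V$; $\vdash M:\mathsf{Circ}(E),E\Downarrow^\alpha\underline n\Rightarrow\mathtt{size}\,M\Downarrow^\alpha\underline n$; $E_0\Downarrow^\alpha\underline m,E_1\Downarrow^{\alpha'}\underline n\Rightarrow\odot E_0E_1\Downarrow^{\alpha\alpha'}\underline{m\odot n}$; $\mathtt{get}\,M\,N$ and $\mathtt{set}\,M\,N$ evaluate (probability $\alpha\alpha'$) from $M\Downarrow^\alpha\underline m$, $N\Downarrow^{\alpha'}\underline n$ to the $n$-th binary digit of $m$, resp. the numeral obtained from $m$ by setting its $n$-th bit to 1; $U\Downarrow U$; $M_0\Downarrow^\alpha C_0,M_1\Downarrow^{\alpha'}C_1\Rightarrow M_0::M_1\Downarrow^{\alpha\alpha'}C_0::C_1$ and $M_0\parallel M_1\Downarrow^{\alpha\alpha'}C_0\parallel C_1$; $\mathtt{reverse}$ evaluates a gate $U$ to $\ddagger U$ and recursively reverses $::$ (swapping order) and $\parallel$ (keeping order), multiplying probabilities; $E\Downarrow^\alpha\underline n, M_0\Downarrow^{\alpha'}C_0,M_1\Downarrow^{\alpha''}C_1\Rightarrow\mathtt{iter}\,E\,M_0\,M_1\Downarrow^{\alpha\alpha'\alpha''}C_1\parallel\cdots\parallel C_1\parallel C_0$ ($n$ copies of $C_1$);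 $M\Downarrow^\alpha\underline m$, $N\Downarrow^{\alpha'}C$, $N:\mathsf{Circ}(\underline k)$, $(n,\alpha'')\in\mathrm{circuitEval}^k(m|_k,C)\Rightarrow\mathtt{dMeas}\,M\,N\Downarrow^{\alpha\alpha'\alpha''}\underline n$, where $\mathrm{circuitEval}^k(x,C)$ is the set of pairs $(i,|\alpha_i|^2)$ with $\mathbf{C}|\varphi_x\rangle=\sum_i\alpha_i|\varphi_i\rangle$ for the unitary $\mathbf C$ on $2^{k+1}$-dimensional Hilbert space (orthonormal basis $|\varphi_i\rangle$) denoted by $C$, and $m|_k$ restricts the binary representation of $m$ to the first $k$ bits. Computability predicate: $\mathrm{Comp}(B,M,\sigma)$ holds iff $B\vdash M:\sigma$ and one of: (1) $B=\emptyset$, $\sigma=\mathsf{Nat}$; (2) $B=\emptyset$, $\sigma=\mathsf{Idx}$ and $M\Downarrow^1\underline n$ for some $n$; (3) $B=\emptyset$, $\sigma=\mathsf{Circ}(E)$ and $\mathrm{Comp}(\emptyset,E,\mathsf{Idx})$; (4) $B=\emptyset$, $\sigma=\Pi x^\mu.\tau$ and $\mathrm{Comp}(\emptyset,MN,\tau[N/x])$ for all $N$ with $\mathrm{Comp}(\emptyset,N,\mu)$; (5) $B=\{x:\nu\}\cup B'$ and $\mathrm{Comp}(B'[N/x],M[N/x],\sigma[N/x])$ for all $N$ with $\mathrm{Comp}(\emptyset,N,\nu)$. -}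

module Defs where

open import Level using (0ℓ)
open import Data.Nat using (ℕ; zero; suc; _+_; _*_; _^_; _%_; _/_)
open import Data.Fin using (Fin; zero; suc)
open import Data.List using (List; []; _∷_)
open import Data.Product using (Σ; ∃; _×_; _,_)
open import Data.Empty using (⊥)
open import Algebra.Bundles using (CommutativeMonoid)

-- Binary-digit helpers (bit 0 = least significant bit)

testBit : ℕ → ℕ → ℕ
testBit m zero    = m % 2
testBit m (suc n) = testBit (m / 2) n

setBit : ℕ → ℕ → ℕ
setBit m n with testBit m n
... | zero  = m + 2 ^ n
... | suc _ = m

restrict : ℕ → ℕ → ℕ
restrict zero    m = 0
restrict (suc k) m = m % 2 + 2 * restrict k (m / 2)

-- Skeletons of types (used only to make the computability predicate
-- structurally recursive; shape is invariant under substitution)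

data Skel : Set where
  snat sidx scirc : Skel
  sarr : Skel → Skel → Skel

-- qPCF, parameterised by
--   Gate k       : the gate names U(k) acting on k+1 qubits
--   ‡            : the total arity-preserving map on gates
--   P            : the (multiplicative) monoid of probabilities
--                  (abstract, since there are no reals in agda-stdlib)
--   circuitEval  : circuitEval k x C n α  means  (n , α) ∈ circuitEval^k(x , C)

module qPCF (Gate : ℕ → Set)
            (‡ : ∀ {k} → Gate k → Gate k)
            (P : CommutativeMonoid 0ℓ 0ℓ)
            where

  open CommutativeMonoid P renaming (Carrier to Prob; _∙_ to _·_; ε to 𝟙)

  data Circuit : Set where
    cgate : ∀ {k} → Gate k → Circuit
    cseq  : Circuit → Circuit → Circuit
    cpar  : Circuit → Circuit → Circuit

  data Ty (n : ℕ) : Set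
  data Tm (n : ℕ) : Set

  data Ty n where
    nat  : Ty n
    idx  : Ty n
    circ : Tm n → Ty n
    pi   : Ty n → Ty (suc n) → Ty n

  data Tm n where
    var     : Fin n → Tm n
    lam     : Ty n → Tm (suc n) → Tm n
    app     : Tm n → Tm n → Tm n
    num     : ℕ → Tm n
    predT   : Tm n
    succT   : Tm n
    ifT     : Tm n
    Y       : Ty n → Tm n
    setT    : Tm n
    getT    : Tm n
    gate    : ∀ {k} → Gate k → Tm n
    seq     : Tm n
    par     : Tm n
    iter    : Tm n
    reverse : Tm n
    plus    : Tm n → Tm n → Tm n
    times   : Tm n → Tm n → Tm n
    size    : Tm n
    dMeas   : Tm n

  ext : ∀ {n m} → (Fin n → Fin m) → Fin (suc n) → Fin (suc m)
  ext ρ zero    = zero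
  ext ρ (suc i) = suc (ρ i)

  renTy : ∀ {n m} → (Fin n → Fin m) → Ty n → Ty m
  ren   : ∀ {n m} → (Fin n → Fin m) → Tm n → Tm m
  renTy ρ nat      = nat
  renTy ρ idx      = idx
  renTy ρ (circ E) = circ (ren ρ E)
  renTy ρ (pi σ τ) = pi (renTy ρ σ) (renTy (ext ρ) τ)
  ren ρ (var i)     = var (ρ i)
  ren ρ (lam σ M)   = lam (renTy ρ σ) (ren (ext ρ) M)
  ren ρ (app M N)   = app (ren ρ M) (ren ρ N)
  ren ρ (num k)     = num k
  ren ρ predT       = predT
  ren ρ succT       = succT
  ren ρ ifT         = ifT
  ren ρ (Y σ)       = Y (renTy ρ σ)
  ren ρ setT        = setT
  ren ρ getT        = getT
  ren ρ (gate U)    = gate U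
  ren ρ seq         = seq
  ren ρ par         = par
  ren ρ iter        = iter
  ren ρ reverse     = reverse
  ren ρ (plus E F)  = plus (ren ρ E) (ren ρ F)
  ren ρ (times E F) = times (ren ρ E) (ren ρ F)
  ren ρ size        = size
  ren ρ dMeas       = dMeas

  wk : ∀ {n} → Tm n → Tm (suc n)
  wk = ren suc

  wkTy : ∀ {n} → Ty n → Ty (suc n)
  wkTy = renTy suc

  exts : ∀ {n m} → (Fin n → Tm m) → Fin (suc n) → Tm (suc m)
  exts s zero    = var zero
  exts s (suc i) = wk (s i)

  subTy : ∀ {n m} → (Fin n → Tm m) → Ty n → Ty m
  sub   : ∀ {n m} → (Fin n → Tm m) → Tm n → Tm m
  subTy s nat      = nat
  subTy s idx      = idx
  subTy s (circ E) = circ (sub s E)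
  subTy s (pi σ τ) = pi (subTy s σ) (subTy (exts s) τ)
  sub s (var i)     = s i
  sub s (lam σ M)   = lam (subTy s σ) (sub (exts s) M)
  sub s (app M N)   = app (sub s M) (sub s N)
  sub s (num k)     = num k
  sub s predT       = predT
  sub s succT       = succT
  sub s ifT         = ifT
  sub s (Y σ)       = Y (subTy s σ)
  sub s setT        = setT
  sub s getT        = getT
  sub s (gate U)    = gate U
  sub s seq         = seq
  sub s par         = par
  sub s iter        = iter
  sub s reverse     = reverse
  sub s (plus E F)  = plus (sub s E) (sub s F)
  sub s (times E F) = times (sub s E) (sub s F)
  sub s size        = size
  sub s dMeas       = dMeas

  sub0 : ∀ {n} → Tm n → Fin (suc n) → Tm n
  sub0 N zero    = N
  sub0 N (suc i) = var i

  _[_] : ∀ {n} → Tm (suc n) → Tm n → Tm n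
  M [ N ] = sub (sub0 N) M

  _[_]ty : ∀ {n} → Ty (suc n) → Tm n → Ty n
  τ [ N ]ty = subTy (sub0 N) τ

  infixr 5 _⇒_
  _⇒_ : ∀ {n} → Ty n → Ty n → Ty n
  σ ⇒ τ = pi σ (wkTy τ)

  app2 : ∀ {n} → Tm n → Tm n → Tm n → Tm n
  app2 F M N = app (app F M) N

  app3 : ∀ {n} → Tm n → Tm n → Tm n → Tm n → Tm n
  app3 F M N L = app (app (app F M) N) L

  data _≈t_ {n} : Tm n → Tm n → Set
  data _≅_ {n} : Ty n → Ty n → Set

  data _≈t_ {n} where
    ≈refl  : ∀ {M} → M ≈t M
    ≈sym   : ∀ {M N} → M ≈t N → N ≈t M
    ≈trans : ∀ {M N L} → M ≈t N → N ≈t L → M ≈t L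
    β      : ∀ {σ M N} → app (lam σ M) N ≈t (M [ N ])
    lam-cong   : ∀ {σ σ' M M'} → σ ≅ σ' → M ≈t M' → lam σ M ≈t lam σ' M'
    app-cong   : ∀ {M M' N N'} → M ≈t M' → N ≈t N' → app M N ≈t app M' N'
    Y-cong     : ∀ {σ σ'} → σ ≅ σ' → Y σ ≈t Y σ'
    plus-cong  : ∀ {E E' F F'} → E ≈t E' → F ≈t F' → plus E F ≈t plus E' F'
    times-cong : ∀ {E E' F F'} → E ≈t E' → F ≈t F' → times E F ≈t times E' F'
    plus-assoc  : ∀ {E F G} → plus (plus E F) G ≈t plus E (plus F G)
    plus-comm   : ∀ {E F} → plus E F ≈t plus F E
    times-assoc : ∀ {E F G} → times (times E F) G ≈t times E (times F G)
    times-comm  : ∀ {E F} → times E F ≈t times F E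
    distrib     : ∀ {E F G} → times E (plus F G) ≈t plus (times E F) (times E G)
    plus-neutral  : ∀ {E} → plus (num 0) E ≈t E
    times-neutral : ∀ {E} → times (num 1) E ≈t E

  data _≅_ {n} where
    ≅refl  : ∀ {σ} → σ ≅ σ
    ≅sym   : ∀ {σ τ} → σ ≅ τ → τ ≅ σ
    ≅trans : ∀ {σ τ ρ} → σ ≅ τ → τ ≅ ρ → σ ≅ ρ
    circ-cong : ∀ {E E'} → E ≈t E' → circ E ≅ circ E'
    pi-cong   : ∀ {σ σ' τ τ'} → σ ≅ σ' → τ ≅ τ' → pi σ τ ≅ pi σ' τ'

  -- bases: ordered (dependent) contexts, innermost variable = index 0
  infixl 5 _▸_
  data Ctx : ℕ → Set where
    []  : Ctx 0
    _▸_ : ∀ {n} → Ctx n → Ty n → Ctx (suc n)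

  lookupTy : ∀ {n} → Ctx n → Fin n → Ty n
  lookupTy (Γ ▸ σ) zero    = wkTy σ
  lookupTy (Γ ▸ σ) (suc i) = wkTy (lookupTy Γ i)

  data YTy {n} : Ty n → Set where
    y-nat  : YTy nat
    y-circ : ∀ {E} → YTy (circ E)
    y-arr  : ∀ {τ σ} → YTy σ → YTy (τ ⇒ σ)

  infix 4 _⊢_∶_
  data WFCtx : ∀ {n} → Ctx n → Set
  data WFTy  : ∀ {n} → Ctx n → Ty n → Set
  data _⊢_∶_ : ∀ {n} → Ctx n → Tm n → Ty n → Set

  data WFCtx where
    wf-[] : WFCtx []
    wf-,  : ∀ {n} {Γ : Ctx n} {σ} → WFCtx Γ → WFTy Γ σ → WFCtx (Γ ▸ σ)

  data WFTy where
    wf-nat  : ∀ {n} {Γ : Ctx n} → WFTy Γ nat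
    wf-idx  : ∀ {n} {Γ : Ctx n} → WFTy Γ idx
    wf-circ : ∀ {n} {Γ : Ctx n} {E} → Γ ⊢ E ∶ idx → WFTy Γ (circ E)
    wf-pi   : ∀ {n} {Γ : Ctx n} {σ τ} → WFTy Γ σ → WFTy (Γ ▸ σ) τ → WFTy Γ (pi σ τ)

  data _⊢_∶_ where
    t-var  : ∀ {n} {Γ : Ctx n} {i} → WFCtx Γ → Γ ⊢ var i ∶ lookupTy Γ i
    t-lam  : ∀ {n} {Γ : Ctx n} {σ N τ} → (Γ ▸ σ) ⊢ N ∶ τ → Γ ⊢ lam σ N ∶ pi σ τ
    t-app  : ∀ {n} {Γ : Ctx n} {P Q σ τ} → Γ ⊢ P ∶ pi σ τ → Γ ⊢ Q ∶ σ → Γ ⊢ app P Q ∶ τ [ Q ]ty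
    t-succ : ∀ {n} {Γ : Ctx n} → WFCtx Γ → Γ ⊢ succT ∶ nat ⇒ nat
    t-pred : ∀ {n} {Γ : Ctx n} → WFCtx Γ → Γ ⊢ predT ∶ nat ⇒ nat
    t-if   : ∀ {n} {Γ : Ctx n} → WFCtx Γ → Γ ⊢ ifT ∶ nat ⇒ nat ⇒ nat ⇒ nat
    t-get  : ∀ {n} {Γ : Ctx n} → WFCtx Γ → Γ ⊢ getT ∶ nat ⇒ nat ⇒ nat
    t-set  : ∀ {n} {Γ : Ctx n} → WFCtx Γ → Γ ⊢ setT ∶ nat ⇒ nat ⇒ nat
    t-num  : ∀ {n} {Γ : Ctx n} {k} → WFCtx Γ → Γ ⊢ num k ∶ idx
    t-gate : ∀ {n} {Γ : Ctx n} {k} {U : Gate k} → WFCtx Γ → Γ ⊢ gate U ∶ circ (num k)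
    t-ifC  : ∀ {n} {Γ : Ctx n} {E} → Γ ⊢ E ∶ idx →
             Γ ⊢ ifT ∶ nat ⇒ circ E ⇒ circ E ⇒ circ E
    t-Y    : ∀ {n} {Γ : Ctx n} {σ} → YTy σ → WFCtx Γ → WFTy Γ σ →
             Γ ⊢ Y σ ∶ (σ ⇒ σ) ⇒ σ
    t-sub  : ∀ {n} {Γ : Ctx n} {M} → Γ ⊢ M ∶ idx → Γ ⊢ M ∶ nat
    t-plus : ∀ {n} {Γ : Ctx n} {E F} → Γ ⊢ E ∶ idx → Γ ⊢ F ∶ idx → Γ ⊢ plus E F ∶ idx
    t-times : ∀ {n} {Γ : Ctx n} {E F} → Γ ⊢ E ∶ idx → Γ ⊢ F ∶ idx → Γ ⊢ times E F ∶ idx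
    t-size : ∀ {n} {Γ : Ctx n} {M E} → Γ ⊢ M ∶ circ E → Γ ⊢ app size M ∶ idx
    t-seq  : ∀ {n} {Γ : Ctx n} {E} → Γ ⊢ E ∶ idx → Γ ⊢ seq ∶ circ E ⇒ circ E ⇒ circ E
    t-reverse : ∀ {n} {Γ : Ctx n} {E} → Γ ⊢ E ∶ idx → Γ ⊢ reverse ∶ circ E ⇒ circ E
    t-dMeas : ∀ {n} {Γ : Ctx n} {E} → Γ ⊢ E ∶ idx → Γ ⊢ dMeas ∶ nat ⇒ circ E ⇒ nat
    t-par  : ∀ {n} {Γ : Ctx n} {E₀ E₁} → Γ ⊢ E₀ ∶ idx → Γ ⊢ E₁ ∶ idx →
             Γ ⊢ par ∶ circ E₀ ⇒ circ E₁ ⇒ circ (plus (plus E₀ E₁) (num 1))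
    t-iter : ∀ {n} {Γ : Ctx n} {E₀ E₁} → Γ ⊢ E₀ ∶ idx → Γ ⊢ E₁ ∶ idx →
             Γ ⊢ iter ∶ pi idx (circ (wk E₀) ⇒ circ (wk E₁) ⇒
                         circ (plus (wk E₀) (times (plus (num 1) (wk E₁)) (var zero))))
    t-conv : ∀ {n} {Γ : Ctx n} {M σ τ} → Γ ⊢ M ∶ σ → σ ≅ τ → WFTy Γ τ → Γ ⊢ M ∶ τ

  data Val : Set where
    vnum  : ℕ → Val
    vcirc : Circuit → Val

  apps : Tm 0 → List (Tm 0) → Tm 0
  apps M []       = M
  apps M (P ∷ Ps) = apps (app M P) Ps

  revC : Circuit → Circuit
  revC (cgate U)  = cgate (‡ U)
  revC (cseq C D) = cseq (revC D) (revC C)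
  revC (cpar C D) = cpar (revC C) (revC D)

  iterC : ℕ → Circuit → Circuit → Circuit
  iterC zero    C₀ C₁ = C₀
  iterC (suc n) C₀ C₁ = cpar C₁ (iterC n C₀ C₁)

  module Eval (circuitEval : ℕ → ℕ → Circuit → ℕ → Prob → Set) where

    infix 4 _⇓[_]_
    data _⇓[_]_ : Tm 0 → Prob → Val → Set where
      e-num  : ∀ {k} → num k ⇓[ 𝟙 ] vnum k
      e-succ : ∀ {M α k} → M ⇓[ α ] vnum k → app succT M ⇓[ α ] vnum (suc k)
      e-pred : ∀ {M α k} → M ⇓[ α ] vnum (suc k) → app predT M ⇓[ α ] vnum k
      e-β    : ∀ {σ M N Ps α V} → apps (M [ N ]) Ps ⇓[ α ] V →
               apps (app (lam σ M) N) Ps ⇓[ α ] V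
      e-if0  : ∀ {M L R α α' V} → M ⇓[ α ] vnum 0 → L ⇓[ α' ] V →
               app3 ifT M L R ⇓[ α · α' ] V
      e-ifS  : ∀ {M L R α α' k V} → M ⇓[ α ] vnum (suc k) → R ⇓[ α' ] V →
               app3 ifT M L R ⇓[ α · α' ] V
      e-Y    : ∀ {σ M Ps α V} → apps (app M (app (Y σ) M)) Ps ⇓[ α ] V →
               apps (app (Y σ) M) Ps ⇓[ α ] V
      e-size : ∀ {M E α k} → [] ⊢ M ∶ circ E → E ⇓[ α ] vnum k →
               app size M ⇓[ α ] vnum k
      e-plus : ∀ {E₀ E₁ α α' m k} → E₀ ⇓[ α ] vnum m → E₁ ⇓[ α' ] vnum k →
               plus E₀ E₁ ⇓[ α · α' ] vnum (m + k)
      e-times : ∀ {E₀ E₁ α α' m k} → E₀ ⇓[ α ] vnum m → E₁ ⇓[ α' ] vnum k →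
               times E₀ E₁ ⇓[ α · α' ] vnum (m * k)
      e-get  : ∀ {M N α α' m k} → M ⇓[ α ] vnum m → N ⇓[ α' ] vnum k →
               app2 getT M N ⇓[ α · α' ] vnum (testBit m k)
      e-set  : ∀ {M N α α' m k} → M ⇓[ α ] vnum m → N ⇓[ α' ] vnum k →
               app2 setT M N ⇓[ α · α' ] vnum (setBit m k)
      e-gate : ∀ {k} {U : Gate k} → gate U ⇓[ 𝟙 ] vcirc (cgate U)
      e-seq  : ∀ {M₀ M₁ α α' C₀ C₁} → M₀ ⇓[ α ] vcirc C₀ → M₁ ⇓[ α' ] vcirc C₁ →
               app2 seq M₀ M₁ ⇓[ α · α' ] vcirc (cseq C₀ C₁)
      e-par  : ∀ {M₀ M₁ α α' C₀ C₁} → M₀ ⇓[ α ] vcirc C₀ → M₁ ⇓[ α' ] vcirc C₁ →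
               app2 par M₀ M₁ ⇓[ α · α' ] vcirc (cpar C₀ C₁)
      e-reverse : ∀ {M α C} → M ⇓[ α ] vcirc C → app reverse M ⇓[ α ] vcirc (revC C)
      e-iter : ∀ {E M₀ M₁ α α' α'' k C₀ C₁} → E ⇓[ α ] vnum k →
               M₀ ⇓[ α' ] vcirc C₀ → M₁ ⇓[ α'' ] vcirc C₁ →
               app3 iter E M₀ M₁ ⇓[ α · α' · α'' ] vcirc (iterC k C₀ C₁)
      e-dMeas : ∀ {M N α α' α'' m k C j} → M ⇓[ α ] vnum m → N ⇓[ α' ] vcirc C →
               [] ⊢ N ∶ circ (num k) → circuitEval k (restrict k m) C j α'' →
               app2 dMeas M N ⇓[ α · α' · α'' ] vnum j

    ⇓¹ : Tm 0 → Set
    ⇓¹ M = Σ ℕ λ k → Σ Prob λ α → (M ⇓[ α ] vnum k) × (α ≈ 𝟙)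

    shape : ∀ {n} → Ty n → Skel
    shape nat      = snat
    shape idx      = sidx
    shape (circ E) = scirc
    shape (pi σ τ) = sarr (shape σ) (shape τ)

    CompIdx : Tm 0 → Set
    CompIdx M = ([] ⊢ M ∶ idx) × ⇓¹ M

    -- closed case, by recursion on the skeleton s (= shape σ)
    Comp₀ : Skel → Tm 0 → Ty 0 → Set
    Comp₀ s M nat      = [] ⊢ M ∶ nat
    Comp₀ s M idx      = CompIdx M
    Comp₀ s M (circ E) = ([] ⊢ M ∶ circ E) × CompIdx E
    Comp₀ (sarr s₁ s₂) M (pi μ τ) =
      ([] ⊢ M ∶ pi μ τ) × (∀ N → Comp₀ s₁ N μ → Comp₀ s₂ (app M N) (τ [ N ]ty))
    Comp₀ _ M (pi μ τ) = ⊥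

    bottom : ∀ {n} → Ctx (suc n) → Ty 0
    bottom {zero}  ([] ▸ ν) = ν
    bottom {suc n} (Γ ▸ σ)  = bottom Γ

    botSub : ∀ n → Tm 0 → Fin (suc n) → Tm n
    botSub zero    N zero    = N
    botSub (suc n) N zero    = var zero
    botSub (suc n) N (suc i) = wk (botSub n N i)

    substBot : ∀ {n} → Tm 0 → Ctx (suc n) → Ctx n
    substBot {zero}  N ([] ▸ ν) = []
    substBot {suc n} N (Γ ▸ σ)  = substBot N Γ ▸ subTy (botSub n N) σ

    Comp : ∀ {n} → Ctx n → Tm n → Ty n → Set
    Comp {zero}  [] M σ = Comp₀ (shape σ) M σ
    Comp {suc n} Γ  M σ =
      (Γ ⊢ M ∶ σ) ×
      (∀ N → Comp₀ (shape (bottom Γ)) N (bottom Γ) →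
             Comp (substBot N Γ) (sub (botSub n N) M) (subTy (botSub n N) σ))

-- Computability of closed terms reduces to typing plus one semantic fact:
-- every closed term of type Idx evaluates to a numeral with probability 1.
-- That fact is proved with a logical relation (reducibility) on closed
-- terms.  Its recursion is structural in the skeleton of a type, since
-- substituting into a dependent type does not change its skeleton; and at
-- Circ(E) it records that E is convertible to an index term which
-- evaluates, so that it is invariant under the conversion rule.  The open
-- case then follows from stability of typing under substitution.
module Submission where

open import Defs
open import Level using (0ℓ)
open import Data.Nat using (ℕ; zero; suc; _+_; _*_)
open import Data.Fin using (Fin; zero; suc)
open import Data.List using (List; []; _∷_; _++_; map)
open import Data.Product using (Σ; _×_; _,_; proj₁; proj₂)
open import Data.Unit using (⊤; tt)
open import Data.Empty using (⊥)
open import Function using (_∘_)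
open import Relation.Binary.PropositionalEquality hiding ([_])
open import Algebra.Bundles using (CommutativeMonoid)

module Metatheory (Gate : ℕ → Set) (‡ : ∀ {k} → Gate k → Gate k)
                  (P : CommutativeMonoid 0ℓ 0ℓ) where

  open qPCF Gate ‡ P

  Sub : ℕ → ℕ → Set
  Sub n m = Fin n → Tm m

  exts-var : ∀ {n m} {ρ : Fin n → Fin m} {s : Sub n m} →
             (∀ i → s i ≡ var (ρ i)) → ∀ i → exts s i ≡ var (ext ρ i)
  exts-var h zero    = refl
  exts-var h (suc i) = cong wk (h i)

  renTy≡subTy : ∀ {n m} {ρ : Fin n → Fin m} {s : Sub n m} →
                (∀ i → s i ≡ var (ρ i)) → ∀ σ → renTy ρ σ ≡ subTy s σ
  ren≡sub     : ∀ {n m} {ρ : Fin n → Fin m} {s : Sub n m} →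
                (∀ i → s i ≡ var (ρ i)) → ∀ M → ren ρ M ≡ sub s M
  renTy≡subTy h nat      = refl
  renTy≡subTy h idx      = refl
  renTy≡subTy h (circ E) = cong circ (ren≡sub h E)
  renTy≡subTy h (pi σ τ) = cong₂ pi (renTy≡subTy h σ) (renTy≡subTy (exts-var h) τ)
  ren≡sub h (var i)     = sym (h i)
  ren≡sub h (lam σ M)   = cong₂ lam (renTy≡subTy h σ) (ren≡sub (exts-var h) M)
  ren≡sub h (app M N)   = cong₂ app (ren≡sub h M) (ren≡sub h N)
  ren≡sub h (Y σ)       = cong Y (renTy≡subTy h σ)
  ren≡sub h (plus E F)  = cong₂ plus (ren≡sub h E) (ren≡sub h F)
  ren≡sub h (times E F) = cong₂ times (ren≡sub h E) (ren≡sub h F)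
  ren≡sub h (num k)     = refl
  ren≡sub h (gate U)    = refl
  ren≡sub h predT       = refl
  ren≡sub h succT       = refl
  ren≡sub h ifT         = refl
  ren≡sub h setT        = refl
  ren≡sub h getT        = refl
  ren≡sub h seq         = refl
  ren≡sub h par         = refl
  ren≡sub h iter        = refl
  ren≡sub h reverse     = refl
  ren≡sub h size        = refl
  ren≡sub h dMeas       = refl

  exts-id : ∀ {n} {s : Sub n n} → (∀ i → s i ≡ var i) → ∀ i → exts s i ≡ var i
  exts-id h zero    = refl
  exts-id h (suc i) = cong wk (h i)

  subTy-id : ∀ {n} {s : Sub n n} → (∀ i → s i ≡ var i) → ∀ σ → subTy s σ ≡ σ
  sub-id   : ∀ {n} {s : Sub n n} → (∀ i → s i ≡ var i) → ∀ M → sub s M ≡ M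
  subTy-id h nat      = refl
  subTy-id h idx      = refl
  subTy-id h (circ E) = cong circ (sub-id h E)
  subTy-id h (pi σ τ) = cong₂ pi (subTy-id h σ) (subTy-id (exts-id h) τ)
  sub-id h (var i)     = h i
  sub-id h (lam σ M)   = cong₂ lam (subTy-id h σ) (sub-id (exts-id h) M)
  sub-id h (app M N)   = cong₂ app (sub-id h M) (sub-id h N)
  sub-id h (Y σ)       = cong Y (subTy-id h σ)
  sub-id h (plus E F)  = cong₂ plus (sub-id h E) (sub-id h F)
  sub-id h (times E F) = cong₂ times (sub-id h E) (sub-id h F)
  sub-id h (num k)     = refl
  sub-id h (gate U)    = refl
  sub-id h predT       = refl
  sub-id h succT       = refl
  sub-id h ifT         = refl
  sub-id h setT        = refl
  sub-id h getT        = refl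
  sub-id h seq         = refl
  sub-id h par         = refl
  sub-id h iter        = refl
  sub-id h reverse     = refl
  sub-id h size        = refl
  sub-id h dMeas       = refl

  -- R s s' t is a hypothesis guaranteeing sub s' ∘ s = t that survives
  -- going under a binder; the three instances below bootstrap the general
  -- composition law from the cases where s or s' is a renaming.
  module Fusion
    (R      : ∀ {n m k} → Sub n m → Sub m k → Sub n k → Set)
    (R-exts : ∀ {n m k} {s : Sub n m} {s' : Sub m k} {t} →
              R s s' t → R (exts s) (exts s') (exts t))
    (R-sound : ∀ {n m k} {s : Sub n m} {s' : Sub m k} {t} →
               R s s' t → ∀ i → sub s' (s i) ≡ t i)
    where

    fuseTy : ∀ {n m k} {s : Sub n m} {s' : Sub m k} {t} →
             R s s' t → ∀ σ → subTy s' (subTy s σ) ≡ subTy t σ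
    fuse   : ∀ {n m k} {s : Sub n m} {s' : Sub m k} {t} →
             R s s' t → ∀ M → sub s' (sub s M) ≡ sub t M
    fuseTy r nat      = refl
    fuseTy r idx      = refl
    fuseTy r (circ E) = cong circ (fuse r E)
    fuseTy r (pi σ τ) = cong₂ pi (fuseTy r σ) (fuseTy (R-exts r) τ)
    fuse r (var i)     = R-sound r i
    fuse r (lam σ M)   = cong₂ lam (fuseTy r σ) (fuse (R-exts r) M)
    fuse r (app M N)   = cong₂ app (fuse r M) (fuse r N)
    fuse r (Y σ)       = cong Y (fuseTy r σ)
    fuse r (plus E F)  = cong₂ plus (fuse r E) (fuse r F)
    fuse r (times E F) = cong₂ times (fuse r E) (fuse r F)
    fuse r (num k)     = refl
    fuse r (gate U)    = refl
    fuse r predT       = refl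
    fuse r succT       = refl
    fuse r ifT         = refl
    fuse r setT        = refl
    fuse r getT        = refl
    fuse r seq         = refl
    fuse r par         = refl
    fuse r iter        = refl
    fuse r reverse     = refl
    fuse r size        = refl
    fuse r dMeas       = refl

  RenamingFirst : ∀ {n m k} → Sub n m → Sub m k → Sub n k → Set
  RenamingFirst {n} {m} s s' t =
    Σ (Fin n → Fin m) λ ρ → (∀ i → s i ≡ var (ρ i)) × (∀ i → s' (ρ i) ≡ t i)

  RenamingFirst-exts : ∀ {n m k} {s : Sub n m} {s' : Sub m k} {t} →
                       RenamingFirst s s' t → RenamingFirst (exts s) (exts s') (exts t)
  RenamingFirst-exts (ρ , h , h') = ext ρ , exts-var h , lifted
    where
    lifted : ∀ i → exts _ (ext ρ i) ≡ exts _ i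
    lifted zero    = refl
    lifted (suc i) = cong wk (h' i)

  RenamingFirst-sound : ∀ {n m k} {s : Sub n m} {s' : Sub m k} {t} →
                        RenamingFirst s s' t → ∀ i → sub s' (s i) ≡ t i
  RenamingFirst-sound {s' = s'} (ρ , h , h') i = trans (cong (sub s') (h i)) (h' i)

  module RenFirst = Fusion RenamingFirst RenamingFirst-exts RenamingFirst-sound

  subTy-wkTy : ∀ {n m} {s : Sub (suc n) m} {t : Sub n m} →
               (∀ i → s (suc i) ≡ t i) → ∀ σ → subTy s (wkTy σ) ≡ subTy t σ
  subTy-wkTy {s = s} h σ =
    trans (cong (subTy s) (renTy≡subTy (λ _ → refl) σ)) (RenFirst.fuseTy (suc , (λ _ → refl) , h) σ)

  sub-wk : ∀ {n m} {s : Sub (suc n) m} {t : Sub n m} →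
           (∀ i → s (suc i) ≡ t i) → ∀ M → sub s (wk M) ≡ sub t M
  sub-wk {s = s} h M =
    trans (cong (sub s) (ren≡sub (λ _ → refl) M)) (RenFirst.fuse (suc , (λ _ → refl) , h) M)

  ren-ren : ∀ {n m k} {ρ : Fin n → Fin m} {ρ' : Fin m → Fin k} {χ : Fin n → Fin k} →
            (∀ i → ρ' (ρ i) ≡ χ i) → ∀ M → ren ρ' (ren ρ M) ≡ ren χ M
  ren-ren {ρ = ρ} {ρ'} {χ} h M = begin
    ren ρ' (ren ρ M)                 ≡⟨ cong (ren ρ') (ren≡sub (λ _ → refl) M) ⟩
    ren ρ' (sub (var ∘ ρ) M)         ≡⟨ ren≡sub (λ _ → refl) _ ⟩
    sub (var ∘ ρ') (sub (var ∘ ρ) M) ≡⟨ RenFirst.fuse (ρ , (λ _ → refl) , λ i → cong var (h i)) M ⟩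
    sub (var ∘ χ) M                  ≡⟨ ren≡sub (λ _ → refl) M ⟨
    ren χ M                          ∎
    where open ≡-Reasoning

  RenamingSecond : ∀ {n m k} → Sub n m → Sub m k → Sub n k → Set
  RenamingSecond {n} {m} {k} s s' t =
    Σ (Fin m → Fin k) λ ρ → (∀ i → s' i ≡ var (ρ i)) × (∀ i → ren ρ (s i) ≡ t i)

  ren-ext-wk : ∀ {n m} (ρ : Fin n → Fin m) M → ren (ext ρ) (wk M) ≡ wk (ren ρ M)
  ren-ext-wk ρ M = trans (ren-ren (λ _ → refl) M) (sym (ren-ren (λ _ → refl) M))

  RenamingSecond-exts : ∀ {n m k} {s : Sub n m} {s' : Sub m k} {t} →
                        RenamingSecond s s' t → RenamingSecond (exts s) (exts s') (exts t)
  RenamingSecond-exts {s = s} (ρ , h , h') = ext ρ , exts-var h , lifted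
    where
    lifted : ∀ i → ren (ext ρ) (exts s i) ≡ exts _ i
    lifted zero    = refl
    lifted (suc i) = trans (ren-ext-wk ρ (s i)) (cong wk (h' i))

  RenamingSecond-sound : ∀ {n m k} {s : Sub n m} {s' : Sub m k} {t} →
                         RenamingSecond s s' t → ∀ i → sub s' (s i) ≡ t i
  RenamingSecond-sound (ρ , h , h') i = trans (sym (ren≡sub h _)) (h' i)

  module RenSecond = Fusion RenamingSecond RenamingSecond-exts RenamingSecond-sound

  wkTy-subTy : ∀ {n m} {s : Sub n m} {t : Sub n (suc m)} →
               (∀ i → wk (s i) ≡ t i) → ∀ σ → wkTy (subTy s σ) ≡ subTy t σ
  wkTy-subTy h σ = trans (renTy≡subTy (λ _ → refl) _) (RenSecond.fuseTy (suc , (λ _ → refl) , h) σ)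

  wk-sub : ∀ {n m} {s : Sub n m} {t : Sub n (suc m)} →
           (∀ i → wk (s i) ≡ t i) → ∀ M → wk (sub s M) ≡ sub t M
  wk-sub h M = trans (ren≡sub (λ _ → refl) _) (RenSecond.fuse (suc , (λ _ → refl) , h) M)

  subTy-wkTy-comm : ∀ {n m} {s : Sub n m} {t : Sub (suc n) (suc m)} →
                    (∀ i → t (suc i) ≡ wk (s i)) → ∀ σ → subTy t (wkTy σ) ≡ wkTy (subTy s σ)
  subTy-wkTy-comm h σ = trans (subTy-wkTy h σ) (sym (wkTy-subTy (λ _ → refl) σ))

  sub-wk-comm : ∀ {n m} {s : Sub n m} {t : Sub (suc n) (suc m)} →
                (∀ i → t (suc i) ≡ wk (s i)) → ∀ M → sub t (wk M) ≡ wk (sub s M)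
  sub-wk-comm h M = trans (sub-wk h M) (sym (wk-sub (λ _ → refl) M))

  record Composes {n m k} (s : Sub n m) (s' : Sub m k) (t : Sub n k) : Set where
    constructor composes
    field pointwise : ∀ i → sub s' (s i) ≡ t i

  Composes-exts : ∀ {n m k} {s : Sub n m} {s' : Sub m k} {t} →
                  Composes s s' t → Composes (exts s) (exts s') (exts t)
  Composes-exts {s = s} (composes h) = composes lifted
    where
    lifted : ∀ i → sub (exts _) (exts s i) ≡ exts _ i
    lifted zero    = refl
    lifted (suc i) = trans (sub-wk-comm (λ _ → refl) (s i)) (cong wk (h i))

  module Compose = Fusion Composes Composes-exts Composes.pointwise

  subTy-subTy : ∀ {n m k} {s : Sub n m} {s' : Sub m k} {t : Sub n k} →
                (∀ i → sub s' (s i) ≡ t i) → ∀ σ → subTy s' (subTy s σ) ≡ subTy t σ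
  subTy-subTy h = Compose.fuseTy (composes h)

  sub-sub : ∀ {n m k} {s : Sub n m} {s' : Sub m k} {t : Sub n k} →
            (∀ i → sub s' (s i) ≡ t i) → ∀ M → sub s' (sub s M) ≡ sub t M
  sub-sub h = Compose.fuse (composes h)

  wkTy-[] : ∀ {n} (N : Tm n) σ → wkTy σ [ N ]ty ≡ σ
  wkTy-[] N σ = trans (subTy-wkTy (λ _ → refl) σ) (subTy-id (λ _ → refl) σ)

  wk-[] : ∀ {n} (N : Tm n) M → wk M [ N ] ≡ M
  wk-[] N M = trans (sub-wk (λ _ → refl) M) (sub-id (λ _ → refl) M)

  sub-sub0 : ∀ {n m} (s : Sub n m) Q → ∀ i → sub (sub0 (sub s Q)) (exts s i) ≡ sub s (sub0 Q i)
  sub-sub0 s Q zero    = refl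
  sub-sub0 s Q (suc i) = wk-[] (sub s Q) (s i)

  subTy-[] : ∀ {n m} (s : Sub n m) τ Q → subTy s (τ [ Q ]ty) ≡ subTy (exts s) τ [ sub s Q ]ty
  subTy-[] s τ Q = trans (subTy-subTy (λ _ → refl) τ) (sym (subTy-subTy (sub-sub0 s Q) τ))

  sub-[] : ∀ {n m} (s : Sub n m) M Q → sub s (M [ Q ]) ≡ sub (exts s) M [ sub s Q ]
  sub-[] s M Q = trans (sub-sub (λ _ → refl) M) (sym (sub-sub (sub-sub0 s Q) M))

  infixl 5 _,ₛ_
  _,ₛ_ : ∀ {n} → Sub n 0 → Tm 0 → Sub (suc n) 0
  (γ ,ₛ N) zero    = N
  (γ ,ₛ N) (suc i) = γ i

  exts-[] : ∀ {n} (γ : Sub n 0) N → ∀ i → sub (sub0 N) (exts γ i) ≡ (γ ,ₛ N) i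
  exts-[] γ N zero    = refl
  exts-[] γ N (suc i) = wk-[] N (γ i)

  subTy-,ₛ : ∀ {n} (γ : Sub n 0) N τ → subTy (γ ,ₛ N) τ ≡ subTy (exts γ) τ [ N ]ty
  subTy-,ₛ γ N τ = sym (subTy-subTy (exts-[] γ N) τ)

  sub-,ₛ : ∀ {n} (γ : Sub n 0) N M → sub (γ ,ₛ N) M ≡ sub (exts γ) M [ N ]
  sub-,ₛ γ N M = sym (sub-sub (exts-[] γ N) M)

  subTy-⇒ : ∀ {n m} (s : Sub n m) σ τ → subTy s (σ ⇒ τ) ≡ subTy s σ ⇒ subTy s τ
  subTy-⇒ s σ τ = cong (pi (subTy s σ)) (subTy-wkTy-comm (λ _ → refl) τ)

  infixr 5 _⇒*_
  _⇒*_ : ∀ {n} → List (Ty n) → Ty n → Ty n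
  []       ⇒* τ = τ
  (σ ∷ σs) ⇒* τ = σ ⇒ σs ⇒* τ

  subTy-⇒* : ∀ {n m} (s : Sub n m) σs τ → subTy s (σs ⇒* τ) ≡ map (subTy s) σs ⇒* subTy s τ
  subTy-⇒* s []       τ = refl
  subTy-⇒* s (σ ∷ σs) τ = trans (subTy-⇒ s σ (σs ⇒* τ)) (cong (subTy s σ ⇒_) (subTy-⇒* s σs τ))

  subTy-Y : ∀ {n m} (s : Sub n m) σ → subTy s ((σ ⇒ σ) ⇒ σ) ≡ (subTy s σ ⇒ subTy s σ) ⇒ subTy s σ
  subTy-Y s σ = trans (subTy-⇒ s (σ ⇒ σ) σ) (cong (_⇒ subTy s σ) (subTy-⇒ s σ σ))

  iterInstance : ∀ {n} → Tm n → Tm n → Tm n → Ty n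
  iterInstance E₀ E₁ K = circ E₀ ⇒ circ E₁ ⇒ circ (plus E₀ (times (plus (num 1) E₁) K))

  subTy-iterInstance : ∀ {n m} (s : Sub n m) E₀ E₁ K →
                       subTy s (iterInstance E₀ E₁ K) ≡ iterInstance (sub s E₀) (sub s E₁) (sub s K)
  subTy-iterInstance s E₀ E₁ K =
    subTy-⇒* s (circ E₀ ∷ circ E₁ ∷ []) (circ (plus E₀ (times (plus (num 1) E₁) K)))

  iterInstance-[] : ∀ {n} (E₀ E₁ K : Tm n) →
                    iterInstance (wk E₀) (wk E₁) (var zero) [ K ]ty ≡ iterInstance E₀ E₁ K
  iterInstance-[] E₀ E₁ K =
    trans (subTy-iterInstance (sub0 K) (wk E₀) (wk E₁) (var zero))
          (cong₂ (λ A B → iterInstance A B K) (wk-[] K E₀) (wk-[] K E₁))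

  iterTy : ∀ {n} → Tm n → Tm n → Ty n
  iterTy E₀ E₁ = pi idx (iterInstance (wk E₀) (wk E₁) (var zero))

  subTy-iterTy : ∀ {n m} (s : Sub n m) E₀ E₁ → subTy s (iterTy E₀ E₁) ≡ iterTy (sub s E₀) (sub s E₁)
  subTy-iterTy s E₀ E₁ = cong (pi idx)
    (trans (subTy-iterInstance (exts s) (wk E₀) (wk E₁) (var zero))
           (cong₂ (λ A B → iterInstance A B (var zero))
                  (sub-wk-comm (λ _ → refl) E₀) (sub-wk-comm (λ _ → refl) E₁)))

  subTy-YTy : ∀ {n m} (s : Sub n m) {σ} → YTy σ → YTy (subTy s σ)
  subTy-YTy s y-nat             = y-nat
  subTy-YTy s y-circ            = y-circ
  subTy-YTy s (y-arr {τ} {σ} y) = subst YTy (sym (subTy-⇒ s τ σ)) (y-arr (subTy-YTy s y))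

  sub-≈t  : ∀ {n m} (s : Sub n m) {M N} → M ≈t N → sub s M ≈t sub s N
  subTy-≅ : ∀ {n m} (s : Sub n m) {σ τ} → σ ≅ τ → subTy s σ ≅ subTy s τ
  sub-≈t s ≈refl               = ≈refl
  sub-≈t s (≈sym e)            = ≈sym (sub-≈t s e)
  sub-≈t s (≈trans e e')       = ≈trans (sub-≈t s e) (sub-≈t s e')
  sub-≈t s (β {σ} {M} {N})     =
    subst (app (lam (subTy s σ) (sub (exts s) M)) (sub s N) ≈t_) (sym (sub-[] s M N)) β
  sub-≈t s (lam-cong e e')     = lam-cong (subTy-≅ s e) (sub-≈t (exts s) e')
  sub-≈t s (app-cong e e')     = app-cong (sub-≈t s e) (sub-≈t s e')
  sub-≈t s (Y-cong e)          = Y-cong (subTy-≅ s e)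
  sub-≈t s (plus-cong e e')    = plus-cong (sub-≈t s e) (sub-≈t s e')
  sub-≈t s (times-cong e e')   = times-cong (sub-≈t s e) (sub-≈t s e')
  sub-≈t s plus-assoc          = plus-assoc
  sub-≈t s plus-comm           = plus-comm
  sub-≈t s times-assoc         = times-assoc
  sub-≈t s times-comm          = times-comm
  sub-≈t s distrib             = distrib
  sub-≈t s plus-neutral        = plus-neutral
  sub-≈t s times-neutral       = times-neutral
  subTy-≅ s ≅refl          = ≅refl
  subTy-≅ s (≅sym e)       = ≅sym (subTy-≅ s e)
  subTy-≅ s (≅trans e e')  = ≅trans (subTy-≅ s e) (subTy-≅ s e')
  subTy-≅ s (circ-cong e)  = circ-cong (sub-≈t s e)
  subTy-≅ s (pi-cong e e') = pi-cong (subTy-≅ s e) (subTy-≅ (exts s) e')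

  retype : ∀ {n} {Γ : Ctx n} {M σ τ} → σ ≡ τ → Γ ⊢ M ∶ σ → Γ ⊢ M ∶ τ
  retype refl d = d

  ⊢-ctx : ∀ {n} {Γ : Ctx n} {M σ} → Γ ⊢ M ∶ σ → WFCtx Γ
  ⊢-ctx (t-var w)       = w
  ⊢-ctx (t-lam d) with ⊢-ctx d
  ... | wf-, w _        = w
  ⊢-ctx (t-app d _)     = ⊢-ctx d
  ⊢-ctx (t-succ w)      = w
  ⊢-ctx (t-pred w)      = w
  ⊢-ctx (t-if w)        = w
  ⊢-ctx (t-get w)       = w
  ⊢-ctx (t-set w)       = w
  ⊢-ctx (t-num w)       = w
  ⊢-ctx (t-gate w)      = w
  ⊢-ctx (t-ifC d)       = ⊢-ctx d
  ⊢-ctx (t-Y _ w _)     = w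
  ⊢-ctx (t-sub d)       = ⊢-ctx d
  ⊢-ctx (t-plus d _)    = ⊢-ctx d
  ⊢-ctx (t-times d _)   = ⊢-ctx d
  ⊢-ctx (t-size d)      = ⊢-ctx d
  ⊢-ctx (t-seq d)       = ⊢-ctx d
  ⊢-ctx (t-reverse d)   = ⊢-ctx d
  ⊢-ctx (t-dMeas d)     = ⊢-ctx d
  ⊢-ctx (t-par d _)     = ⊢-ctx d
  ⊢-ctx (t-iter d _)    = ⊢-ctx d
  ⊢-ctx (t-conv d _ _)  = ⊢-ctx d

  -- Substitutions are typed entrywise by a kit: the instance with variables
  -- yields weakening, which the instance with terms needs under binders.
  record Kit : Set₁ where
    infix 4 _∋_∶_
    field
      _∋_∶_  : ∀ {m} → Ctx m → Tm m → Ty m → Set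
      ∋-zero : ∀ {m} {Δ : Ctx m} {A} → WFCtx (Δ ▸ A) → Δ ▸ A ∋ var zero ∶ wkTy A
      ∋-wk   : ∀ {m} {Δ : Ctx m} {A M T} → WFTy Δ A → Δ ∋ M ∶ T → Δ ▸ A ∋ wk M ∶ wkTy T
      ∋⇒⊢    : ∀ {m} {Δ : Ctx m} {M T} → WFCtx Δ → Δ ∋ M ∶ T → Δ ⊢ M ∶ T

  module TypedSubstitution (K : Kit) where

    open Kit K

    ∋-retype : ∀ {m} {Δ : Ctx m} {M T T'} → T ≡ T' → Δ ∋ M ∶ T → Δ ∋ M ∶ T'
    ∋-retype refl e = e

    infix 4 _⇛_
    data _⇛_ : ∀ {n m} → Ctx n → Ctx m → Set
    ⌈_⌉ : ∀ {n m} {Γ : Ctx n} {Δ : Ctx m} → Γ ⇛ Δ → Sub n m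

    data _⇛_ where
      base : ∀ {n m} {Γ : Ctx n} {Δ : Ctx m} (s : Sub n m) → WFCtx Δ →
             (∀ i → Δ ∋ s i ∶ subTy s (lookupTy Γ i)) → Γ ⇛ Δ
      lift : ∀ {n m} {Γ : Ctx n} {Δ : Ctx m} {σ} (θ : Γ ⇛ Δ) → Γ ▸ σ ⇛ Δ ▸ subTy ⌈ θ ⌉ σ

    ⌈ base s _ _ ⌉ = s
    ⌈ lift θ ⌉     = exts ⌈ θ ⌉

    ⇛-WFCtx  : ∀ {n m} {Γ : Ctx n} {Δ : Ctx m} → Γ ⇛ Δ → WFCtx Γ → WFCtx Δ
    ⇛-lookup : ∀ {n m} {Γ : Ctx n} {Δ : Ctx m} (θ : Γ ⇛ Δ) → WFCtx Γ →
               ∀ i → Δ ∋ ⌈ θ ⌉ i ∶ subTy ⌈ θ ⌉ (lookupTy Γ i)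
    WFTy-sub : ∀ {n m} {Γ : Ctx n} {Δ : Ctx m} (θ : Γ ⇛ Δ) {σ} →
               WFTy Γ σ → WFTy Δ (subTy ⌈ θ ⌉ σ)
    ⊢-sub    : ∀ {n m} {Γ : Ctx n} {Δ : Ctx m} (θ : Γ ⇛ Δ) {M σ} →
               Γ ⊢ M ∶ σ → Δ ⊢ sub ⌈ θ ⌉ M ∶ subTy ⌈ θ ⌉ σ

    ⇛-WFCtx (base _ w _) _       = w
    ⇛-WFCtx (lift θ) (wf-, w wσ) = wf-, (⇛-WFCtx θ w) (WFTy-sub θ wσ)

    ⇛-lookup (base _ _ es) _ i = es i
    ⇛-lookup (lift {σ = σ} θ) (wf-, w wσ) zero =
      ∋-retype (sym (subTy-wkTy-comm (λ _ → refl) σ))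
               (∋-zero (⇛-WFCtx (lift θ) (wf-, w wσ)))
    ⇛-lookup {Γ = Γ ▸ σ} (lift θ) (wf-, w wσ) (suc i) =
      ∋-retype (sym (subTy-wkTy-comm (λ _ → refl) (lookupTy Γ i)))
               (∋-wk (WFTy-sub θ wσ) (⇛-lookup θ w i))

    WFTy-sub θ wf-nat       = wf-nat
    WFTy-sub θ wf-idx       = wf-idx
    WFTy-sub θ (wf-circ d)  = wf-circ (⊢-sub θ d)
    WFTy-sub θ (wf-pi w w') = wf-pi (WFTy-sub θ w) (WFTy-sub (lift θ) w')

    ⊢-sub θ (t-var {i = i} w) = ∋⇒⊢ (⇛-WFCtx θ w) (⇛-lookup θ w i)
    ⊢-sub θ (t-lam d)         = t-lam (⊢-sub (lift θ) d)
    ⊢-sub θ (t-app {Q = Q} {τ = τ} dP dQ) =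
      retype (sym (subTy-[] ⌈ θ ⌉ τ Q)) (t-app (⊢-sub θ dP) (⊢-sub θ dQ))
    ⊢-sub θ (t-succ w)        = t-succ (⇛-WFCtx θ w)
    ⊢-sub θ (t-pred w)        = t-pred (⇛-WFCtx θ w)
    ⊢-sub θ (t-if w)          = t-if (⇛-WFCtx θ w)
    ⊢-sub θ (t-get w)         = t-get (⇛-WFCtx θ w)
    ⊢-sub θ (t-set w)         = t-set (⇛-WFCtx θ w)
    ⊢-sub θ (t-num w)         = t-num (⇛-WFCtx θ w)
    ⊢-sub θ (t-gate w)        = t-gate (⇛-WFCtx θ w)
    ⊢-sub θ (t-ifC {E = E} d) =
      retype (sym (subTy-⇒* ⌈ θ ⌉ (nat ∷ circ E ∷ circ E ∷ []) (circ E))) (t-ifC (⊢-sub θ d))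
    ⊢-sub θ (t-Y {σ = σ} y w w') =
      retype (sym (subTy-Y ⌈ θ ⌉ σ)) (t-Y (subTy-YTy ⌈ θ ⌉ y) (⇛-WFCtx θ w) (WFTy-sub θ w'))
    ⊢-sub θ (t-sub d)         = t-sub (⊢-sub θ d)
    ⊢-sub θ (t-plus d d')     = t-plus (⊢-sub θ d) (⊢-sub θ d')
    ⊢-sub θ (t-times d d')    = t-times (⊢-sub θ d) (⊢-sub θ d')
    ⊢-sub θ (t-size d)        = t-size (⊢-sub θ d)
    ⊢-sub θ (t-seq {E = E} d) =
      retype (sym (subTy-⇒* ⌈ θ ⌉ (circ E ∷ circ E ∷ []) (circ E))) (t-seq (⊢-sub θ d))
    ⊢-sub θ (t-reverse {E = E} d) =
      retype (sym (subTy-⇒ ⌈ θ ⌉ (circ E) (circ E))) (t-reverse (⊢-sub θ d))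
    ⊢-sub θ (t-dMeas {E = E} d) =
      retype (sym (subTy-⇒* ⌈ θ ⌉ (nat ∷ circ E ∷ []) nat)) (t-dMeas (⊢-sub θ d))
    ⊢-sub θ (t-par {E₀ = E₀} {E₁} d d') =
      retype (sym (subTy-⇒* ⌈ θ ⌉ (circ E₀ ∷ circ E₁ ∷ []) (circ (plus (plus E₀ E₁) (num 1)))))
             (t-par (⊢-sub θ d) (⊢-sub θ d'))
    ⊢-sub θ (t-iter {E₀ = E₀} {E₁} d d') =
      retype (sym (subTy-iterTy ⌈ θ ⌉ E₀ E₁)) (t-iter (⊢-sub θ d) (⊢-sub θ d'))
    ⊢-sub θ (t-conv d e w)    = t-conv (⊢-sub θ d) (subTy-≅ ⌈ θ ⌉ e) (WFTy-sub θ w)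

  varKit : Kit
  varKit = record
    { _∋_∶_  = λ {m} Δ M T → Σ (Fin m) λ j → (M ≡ var j) × (lookupTy Δ j ≡ T)
    ; ∋-zero = λ _ → zero , refl , refl
    ; ∋-wk   = λ { _ (j , refl , refl) → suc j , refl , refl }
    ; ∋⇒⊢    = λ { w (j , refl , refl) → t-var w }
    }

  module Renaming = TypedSubstitution varKit

  weakening : ∀ {n} {Δ : Ctx n} {A} → WFCtx (Δ ▸ A) → Δ Renaming.⇛ Δ ▸ A
  weakening {Δ = Δ} w = Renaming.base (var ∘ suc) w
    (λ i → suc i , refl , renTy≡subTy (λ _ → refl) (lookupTy Δ i))

  ⊢-wk : ∀ {n} {Δ : Ctx n} {A M τ} → WFTy Δ A → Δ ⊢ M ∶ τ → Δ ▸ A ⊢ wk M ∶ wkTy τ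
  ⊢-wk {M = M} {τ} wA d =
    subst₂ (_ ⊢_∶_) (sym (ren≡sub (λ _ → refl) M)) (sym (renTy≡subTy (λ _ → refl) τ))
           (Renaming.⊢-sub (weakening (wf-, (⊢-ctx d) wA)) d)

  WFTy-wk : ∀ {n} {Δ : Ctx n} {A τ} → WFCtx (Δ ▸ A) → WFTy Δ τ → WFTy (Δ ▸ A) (wkTy τ)
  WFTy-wk {τ = τ} w wτ =
    subst (WFTy _) (sym (renTy≡subTy (λ _ → refl) τ)) (Renaming.WFTy-sub (weakening w) wτ)

  termKit : Kit
  termKit = record
    { _∋_∶_  = _⊢_∶_
    ; ∋-zero = t-var
    ; ∋-wk   = ⊢-wk
    ; ∋⇒⊢    = λ _ d → d
    }

  open TypedSubstitution termKit

  single : ∀ {n} {Γ : Ctx n} {Q σ} → Γ ⊢ Q ∶ σ → Γ ▸ σ ⇛ Γ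
  single {Γ = Γ} {Q} {σ} d = base (sub0 Q) (⊢-ctx d) typed
    where
    typed : ∀ i → Γ ⊢ sub0 Q i ∶ lookupTy (Γ ▸ σ) i [ Q ]ty
    typed zero    = retype (sym (wkTy-[] Q σ)) d
    typed (suc i) = retype (sym (wkTy-[] Q (lookupTy Γ i))) (t-var (⊢-ctx d))

  WFTy-lookup : ∀ {n} {Γ : Ctx n} → WFCtx Γ → ∀ i → WFTy Γ (lookupTy Γ i)
  WFTy-lookup w@(wf-, _ wσ) zero    = WFTy-wk w wσ
  WFTy-lookup w@(wf-, w' _) (suc i) = WFTy-wk w (WFTy-lookup w' i)

  wf-⇒ : ∀ {n} {Γ : Ctx n} {σ τ} → WFCtx Γ → WFTy Γ σ → WFTy Γ τ → WFTy Γ (σ ⇒ τ)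
  wf-⇒ w wσ wτ = wf-pi wσ (WFTy-wk (wf-, w wσ) wτ)

  ⊢-WFTy : ∀ {n} {Γ : Ctx n} {M σ} → Γ ⊢ M ∶ σ → WFTy Γ σ
  ⊢-WFTy (t-var {i = i} w) = WFTy-lookup w i
  ⊢-WFTy (t-lam d) with ⊢-ctx d
  ... | wf-, _ wσ          = wf-pi wσ (⊢-WFTy d)
  ⊢-WFTy (t-app dP dQ) with ⊢-WFTy dP
  ... | wf-pi _ wτ         = WFTy-sub (single dQ) wτ
  ⊢-WFTy (t-succ w)        = wf-⇒ w wf-nat wf-nat
  ⊢-WFTy (t-pred w)        = wf-⇒ w wf-nat wf-nat
  ⊢-WFTy (t-if w)          = wf-⇒ w wf-nat (wf-⇒ w wf-nat (wf-⇒ w wf-nat wf-nat))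
  ⊢-WFTy (t-get w)         = wf-⇒ w wf-nat (wf-⇒ w wf-nat wf-nat)
  ⊢-WFTy (t-set w)         = wf-⇒ w wf-nat (wf-⇒ w wf-nat wf-nat)
  ⊢-WFTy (t-num w)         = wf-idx
  ⊢-WFTy (t-gate w)        = wf-circ (t-num w)
  ⊢-WFTy (t-ifC d)         =
    wf-⇒ w wf-nat (wf-⇒ w (wf-circ d) (wf-⇒ w (wf-circ d) (wf-circ d))) where w = ⊢-ctx d
  ⊢-WFTy (t-Y _ w wσ)      = wf-⇒ w (wf-⇒ w wσ wσ) wσ
  ⊢-WFTy (t-sub d)         = wf-nat
  ⊢-WFTy (t-plus d _)      = wf-idx
  ⊢-WFTy (t-times d _)     = wf-idx
  ⊢-WFTy (t-size d)        = wf-idx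
  ⊢-WFTy (t-seq d)         = wf-⇒ w (wf-circ d) (wf-⇒ w (wf-circ d) (wf-circ d)) where w = ⊢-ctx d
  ⊢-WFTy (t-reverse d)     = wf-⇒ (⊢-ctx d) (wf-circ d) (wf-circ d)
  ⊢-WFTy (t-dMeas d)       = wf-⇒ w wf-nat (wf-⇒ w (wf-circ d) wf-nat) where w = ⊢-ctx d
  ⊢-WFTy (t-par d d')      =
    wf-⇒ w (wf-circ d) (wf-⇒ w (wf-circ d') (wf-circ (t-plus (t-plus d d') (t-num w))))
    where w = ⊢-ctx d
  ⊢-WFTy (t-iter d d')     =
    wf-pi wf-idx (wf-⇒ w (wf-circ d₀) (wf-⇒ w (wf-circ d₁)
      (wf-circ (t-plus d₀ (t-times (t-plus (t-num w) d₁) (t-var w))))))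
    where
    w  = wf-, (⊢-ctx d) wf-idx
    d₀ = ⊢-wk wf-idx d
    d₁ = ⊢-wk wf-idx d'
  ⊢-WFTy (t-conv _ _ w)    = w

  -- An invariant of ≅ which, unlike ≅ itself, can be inverted by pattern matching.
  ConvHead : ∀ {n} → Ty n → Ty n → Set
  ConvHead nat      τ = τ ≡ nat
  ConvHead idx      τ = τ ≡ idx
  ConvHead {n} (circ E) τ = Σ (Tm n) λ E' → (τ ≡ circ E') × (E ≈t E')
  ConvHead {n} (pi μ ρ) τ =
    Σ (Ty n) λ μ' → Σ (Ty (suc n)) λ ρ' → (τ ≡ pi μ' ρ') × (μ ≅ μ') × (ρ ≅ ρ')

  ConvHead-refl : ∀ {n} (σ : Ty n) → ConvHead σ σ
  ConvHead-refl nat      = refl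
  ConvHead-refl idx      = refl
  ConvHead-refl (circ E) = E , refl , ≈refl
  ConvHead-refl (pi μ ρ) = μ , ρ , refl , ≅refl , ≅refl

  ConvHead-sym : ∀ {n} {σ τ : Ty n} → ConvHead σ τ → ConvHead τ σ
  ConvHead-sym {σ = nat}    refl                     = refl
  ConvHead-sym {σ = idx}    refl                     = refl
  ConvHead-sym {σ = circ E} (_ , refl , e)           = E , refl , ≈sym e
  ConvHead-sym {σ = pi μ ρ} (_ , _ , refl , e , e') = μ , ρ , refl , ≅sym e , ≅sym e'

  ConvHead-trans : ∀ {n} {σ ρ τ : Ty n} → ConvHead σ ρ → ConvHead ρ τ → ConvHead σ τ
  ConvHead-trans {σ = nat} refl c = c
  ConvHead-trans {σ = idx} refl c = c
  ConvHead-trans {σ = circ E} (_ , refl , e) (E'' , refl , e') = E'' , refl , ≈trans e e'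
  ConvHead-trans {σ = pi μ ρ} (_ , _ , refl , e₁ , e₂) (μ'' , ρ'' , refl , e₁' , e₂') =
    μ'' , ρ'' , refl , ≅trans e₁ e₁' , ≅trans e₂ e₂'

  ≅⇒ConvHead : ∀ {n} {σ τ : Ty n} → σ ≅ τ → ConvHead σ τ
  ≅⇒ConvHead ≅refl          = ConvHead-refl _
  ≅⇒ConvHead (≅sym e)       = ConvHead-sym (≅⇒ConvHead e)
  ≅⇒ConvHead (≅trans e e')  = ConvHead-trans (≅⇒ConvHead e) (≅⇒ConvHead e')
  ≅⇒ConvHead (circ-cong e)  = _ , refl , e
  ≅⇒ConvHead (pi-cong e e') = _ , _ , refl , e , e'

  module Computability (circuitEval : ℕ → ℕ → Circuit → ℕ → CommutativeMonoid.Carrier P → Set) where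

    open Eval circuitEval
    open CommutativeMonoid P using (_≈_; _∙_; ε; ∙-cong; identityˡ)
      renaming (trans to ≈-trans; refl to ≈-refl)

    shape-subTy : ∀ {n m} (s : Sub n m) σ → shape (subTy s σ) ≡ shape σ
    shape-subTy s nat      = refl
    shape-subTy s idx      = refl
    shape-subTy s (circ E) = refl
    shape-subTy s (pi σ τ) = cong₂ sarr (shape-subTy s σ) (shape-subTy (exts s) τ)

    shape-[] : ∀ {n} σ (N : Tm n) → shape (σ [ N ]ty) ≡ shape σ
    shape-[] σ N = shape-subTy (sub0 N) σ

    shape-≅ : ∀ {n} {σ τ : Ty n} → σ ≅ τ → shape σ ≡ shape τ
    shape-≅ ≅refl          = refl
    shape-≅ (≅sym e)       = sym (shape-≅ e)
    shape-≅ (≅trans e e')  = trans (shape-≅ e) (shape-≅ e')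
    shape-≅ (circ-cong e)  = refl
    shape-≅ (pi-cong e e') = cong₂ sarr (shape-≅ e) (shape-≅ e')

    ∙-≈ε : ∀ {α α'} → α ≈ ε → α' ≈ ε → α ∙ α' ≈ ε
    ∙-≈ε p p' = ≈-trans (∙-cong p p') (identityˡ ε)

    CompIdx-num : ∀ k → CompIdx (num k)
    CompIdx-num k = t-num wf-[] , k , ε , e-num , ≈-refl

    CompIdx-plus : ∀ {E F} → CompIdx E → CompIdx F → CompIdx (plus E F)
    CompIdx-plus (dE , k , α , ev , p) (dF , k' , α' , ev' , p') =
      t-plus dE dF , k + k' , α ∙ α' , e-plus ev ev' , ∙-≈ε p p'

    CompIdx-times : ∀ {E F} → CompIdx E → CompIdx F → CompIdx (times E F)
    CompIdx-times (dE , k , α , ev , p) (dF , k' , α' , ev' , p') =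
      t-times dE dF , k * k' , α ∙ α' , e-times ev ev' , ∙-≈ε p p'

    CompIdx≈ : Tm 0 → Set
    CompIdx≈ E = Σ (Tm 0) λ E' → (E ≈t E') × CompIdx E'

    CompIdx-size : ∀ {M E} → [] ⊢ M ∶ circ E → CompIdx≈ E → CompIdx (app size M)
    CompIdx-size dM (E' , e , dE' , k , α , ev , p) =
      t-size dM , k , α , e-size (t-conv dM (circ-cong e) (wf-circ dE')) ev , p

    Red₀ : Skel → Tm 0 → Ty 0 → Set
    Red₀ _ M nat      = [] ⊢ M ∶ nat
    Red₀ _ M idx      = CompIdx M
    Red₀ _ M (circ E) = ([] ⊢ M ∶ circ E) × CompIdx≈ E
    Red₀ (sarr s t) M (pi μ τ) =
      ([] ⊢ M ∶ pi μ τ) × (∀ N → Red₀ s N μ → Red₀ t (app M N) (τ [ N ]ty))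
    Red₀ snat  M (pi μ τ) = ⊥
    Red₀ sidx  M (pi μ τ) = ⊥
    Red₀ scirc M (pi μ τ) = ⊥

    Red : Ty 0 → Tm 0 → Set
    Red σ M = Red₀ (shape σ) M σ

    -- Reducibility of the type itself: the size indices occurring in it
    -- evaluate once its bound variables are instantiated by reducible terms.
    RedTy₀ : Skel → Ty 0 → Set
    RedTy₀ _ nat      = ⊤
    RedTy₀ _ idx      = ⊤
    RedTy₀ _ (circ E) = CompIdx E
    RedTy₀ (sarr s t) (pi μ τ) = ∀ N → Red₀ s N μ → RedTy₀ t (τ [ N ]ty)
    RedTy₀ snat  (pi μ τ) = ⊥
    RedTy₀ sidx  (pi μ τ) = ⊥
    RedTy₀ scirc (pi μ τ) = ⊥

    RedTy : Ty 0 → Set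
    RedTy σ = RedTy₀ (shape σ) σ

    Red₀-cast : ∀ {s s' σ σ' M} → σ ≡ σ' → s ≡ shape σ → s' ≡ shape σ' → Red₀ s M σ → Red₀ s' M σ'
    Red₀-cast refl refl refl r = r

    RedTy₀-cast : ∀ {s s' σ σ'} → σ ≡ σ' → s ≡ shape σ → s' ≡ shape σ' → RedTy₀ s σ → RedTy₀ s' σ'
    RedTy₀-cast refl refl refl v = v

    Red₀-typed : ∀ {s σ M} → Red₀ s M σ → [] ⊢ M ∶ σ
    Red₀-typed {σ = nat}               d       = d
    Red₀-typed {σ = idx}               (d , _) = d
    Red₀-typed {σ = circ E}            (d , _) = d
    Red₀-typed {sarr _ _} {σ = pi μ τ} (d , _) = d

    apps-snoc : ∀ M Ps N → apps M (Ps ++ N ∷ []) ≡ app (apps M Ps) N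
    apps-snoc M []       N = refl
    apps-snoc M (P ∷ Ps) N = apps-snoc (app M P) Ps N

    Red₀-β-expand : ∀ {s τ σ B N} Ps → Red₀ s (apps (B [ N ]) Ps) τ →
                    [] ⊢ apps (app (lam σ B) N) Ps ∶ τ → Red₀ s (apps (app (lam σ B) N) Ps) τ
    Red₀-β-expand {τ = nat} Ps r d = d
    Red₀-β-expand {τ = idx} {σ} {B} {N} Ps (_ , k , α , ev , p) d =
      d , k , α , e-β {σ = σ} {M = B} {N = N} {Ps = Ps} ev , p
    Red₀-β-expand {τ = circ E} Ps (_ , c) d = d , c
    Red₀-β-expand {sarr s t} {pi μ τ} {σ} {B} {N} Ps (_ , f) d = d , λ N' r →
      subst (λ M → Red₀ t M (τ [ N' ]ty)) (apps-snoc (app (lam σ B) N) Ps N')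
        (Red₀-β-expand (Ps ++ N' ∷ [])
          (subst (λ M → Red₀ t M (τ [ N' ]ty)) (sym (apps-snoc (B [ N ]) Ps N')) (f N' r))
          (subst ([] ⊢_∶ τ [ N' ]ty) (sym (apps-snoc (app (lam σ B) N) Ps N'))
                 (t-app d (Red₀-typed r))))

    Red₀-conv : ∀ {s σ τ M} → Red₀ s M σ → σ ≅ τ → WFTy [] τ → Red₀ s M τ
    Red₀-conv {σ = nat} r e w with ≅⇒ConvHead e
    ... | refl = r
    Red₀-conv {σ = idx} r e w with ≅⇒ConvHead e
    ... | refl = r
    Red₀-conv {σ = circ E} (d , E'' , e'' , c) e w with ≅⇒ConvHead e
    ... | E' , refl , e' = t-conv d e w , E'' , ≈trans (≈sym e') e'' , c
    Red₀-conv {sarr _ _} {pi μ ρ} (d , f) e w with ≅⇒ConvHead e | ⊢-WFTy d | w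
    ... | μ' , ρ' , refl , eμ , eρ | wf-pi wμ _ | wf-pi _ wρ' = t-conv d e w , λ N r →
      Red₀-conv (f N (Red₀-conv r (≅sym eμ) wμ)) (subTy-≅ (sub0 N) eρ)
                (WFTy-sub (single (Red₀-typed r)) wρ')

    Red-retype : ∀ {σ σ' M} → σ ≡ σ' → Red σ M → Red σ' M
    Red-retype refl r = r

    RedTy-⇒ : ∀ {τ σ} → RedTy σ → RedTy (τ ⇒ σ)
    RedTy-⇒ {σ = σ} v N _ = RedTy₀-cast (sym (wkTy-[] N σ)) refl (sym (shape-[] (wkTy σ) N)) v

    RedTy-⇒* : ∀ σs {τ} → RedTy τ → RedTy (σs ⇒* τ)
    RedTy-⇒* []       v = v
    RedTy-⇒* (σ ∷ σs) v = RedTy-⇒ (RedTy-⇒* σs v)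

    YTy-⇒* : ∀ {n} σs {τ : Ty n} → YTy τ → YTy (σs ⇒* τ)
    YTy-⇒* []       y = y
    YTy-⇒* (σ ∷ σs) y = y-arr (YTy-⇒* σs y)

    -- Such a type ends in Nat or Circ(E), where reducibility asks only for
    -- typing and for the evaluation of the size index.
    Red-YTy : ∀ {σ M} → YTy σ → RedTy σ → [] ⊢ M ∶ σ → Red σ M
    Red-YTy y-nat        _ d = d
    Red-YTy (y-circ {E}) c d = d , E , ≈refl , c
    Red-YTy (y-arr {τ} {σ} y) v d = d , λ N r →
      Red₀-cast (sym (wkTy-[] N σ)) refl (sym (shape-[] (wkTy σ) N))
        (Red-YTy y (RedTy₀-cast (wkTy-[] N σ) (sym (shape-[] (wkTy σ) N)) refl (v N r))
                   (retype (wkTy-[] N σ) (t-app d (Red₀-typed r))))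

    Red-iter : ∀ {E₀ E₁} → CompIdx E₀ → CompIdx E₁ → Red (iterTy E₀ E₁) iter
    Red-iter {E₀} {E₁} c₀ c₁ = d , λ N c →
      Red₀-cast (sym (iterInstance-[] E₀ E₁ N)) refl (sym (shape-[] body N))
        (Red-YTy (YTy-⇒* (circ E₀ ∷ circ E₁ ∷ []) y-circ)
                 (RedTy-⇒* (circ E₀ ∷ circ E₁ ∷ [])
                           (CompIdx-plus c₀ (CompIdx-times (CompIdx-plus (CompIdx-num 1) c₁) c)))
                 (retype (iterInstance-[] E₀ E₁ N) (t-app d (proj₁ c))))
      where
      body = iterInstance (wk E₀) (wk E₁) (var zero)
      d    = t-iter (proj₁ c₀) (proj₁ c₁)

    RedSub : ∀ {n} → Ctx n → Sub n 0 → Set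
    RedSub Γ γ = ∀ i → Red (subTy γ (lookupTy Γ i)) (γ i)

    RedSub-⇛ : ∀ {n} {Γ : Ctx n} {γ} → RedSub Γ γ → Γ ⇛ []
    RedSub-⇛ {γ = γ} g = base γ wf-[] (λ i → Red₀-typed (g i))

    RedSub-,ₛ : ∀ {n} {Γ : Ctx n} {γ σ N} → RedSub Γ γ → Red (subTy γ σ) N → RedSub (Γ ▸ σ) (γ ,ₛ N)
    RedSub-,ₛ {σ = σ} g r zero = Red-retype (sym (subTy-wkTy (λ _ → refl) σ)) r
    RedSub-,ₛ {Γ = Γ} g r (suc i) = Red-retype (sym (subTy-wkTy (λ _ → refl) (lookupTy Γ i))) (g i)

    Red-const : ∀ {n} {Γ : Ctx n} {c} σs {τ} γ → RedSub Γ γ → YTy (subTy γ τ) → RedTy (subTy γ τ) →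
                Γ ⊢ c ∶ σs ⇒* τ → Red (subTy γ (σs ⇒* τ)) (sub γ c)
    Red-const σs {τ} γ g y v d =
      Red-retype (sym eq) (Red-YTy (YTy-⇒* (map (subTy γ) σs) y) (RedTy-⇒* (map (subTy γ) σs) v)
                                   (retype eq (⊢-sub (RedSub-⇛ g) d)))
      where eq = subTy-⇒* γ σs τ

    fundamental    : ∀ {n} {Γ : Ctx n} {M σ} → Γ ⊢ M ∶ σ →
                     ∀ γ → RedSub Γ γ → Red (subTy γ σ) (sub γ M)
    fundamental-WF : ∀ {n} {Γ : Ctx n} {σ} → WFTy Γ σ →
                     ∀ γ → RedSub Γ γ → RedTy (subTy γ σ)

    fundamental-WF wf-nat      γ g = tt
    fundamental-WF wf-idx      γ g = tt
    fundamental-WF (wf-circ d) γ g = fundamental d γ g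
    fundamental-WF (wf-pi {τ = τ} _ wτ) γ g N r =
      RedTy₀-cast (subTy-,ₛ γ N τ) refl (sym (shape-[] (subTy (exts γ) τ) N))
        (fundamental-WF wτ (γ ,ₛ N) (RedSub-,ₛ g r))

    fundamental (t-var {i = i} _) γ g = g i
    fundamental d@(t-lam {N = M} {τ} d') γ g = ⊢-sub (RedSub-⇛ g) d , λ N r →
      Red₀-β-expand []
        (Red₀-cast (subTy-,ₛ γ N τ) refl (sym (shape-[] (subTy (exts γ) τ) N))
          (subst (Red (subTy (γ ,ₛ N) τ)) (sub-,ₛ γ N M) (fundamental d' (γ ,ₛ N) (RedSub-,ₛ g r))))
        (t-app (⊢-sub (RedSub-⇛ g) d) (Red₀-typed r))
    fundamental (t-app {Q = Q} {τ = τ} dP dQ) γ g =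
      Red₀-cast (sym (subTy-[] γ τ Q)) (sym (shape-[] (subTy (exts γ) τ) (sub γ Q))) refl
        (proj₂ (fundamental dP γ g) (sub γ Q) (fundamental dQ γ g))
    fundamental d@(t-succ _) γ g = Red-const (nat ∷ []) γ g y-nat tt d
    fundamental d@(t-pred _) γ g = Red-const (nat ∷ []) γ g y-nat tt d
    fundamental d@(t-if _)   γ g = Red-const (nat ∷ nat ∷ nat ∷ []) γ g y-nat tt d
    fundamental d@(t-get _)  γ g = Red-const (nat ∷ nat ∷ []) γ g y-nat tt d
    fundamental d@(t-set _)  γ g = Red-const (nat ∷ nat ∷ []) γ g y-nat tt d
    fundamental (t-num {k = k} _)  γ g = CompIdx-num k
    fundamental (t-gate {k = k} _) γ g = t-gate wf-[] , num k , ≈refl , CompIdx-num k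
    fundamental d@(t-ifC {E = E} dE) γ g =
      Red-const (nat ∷ circ E ∷ circ E ∷ []) γ g y-circ (fundamental dE γ g) d
    fundamental d@(t-Y {σ = σ} y _ wσ) γ g =
      Red-const ((σ ⇒ σ) ∷ []) γ g (subTy-YTy γ y) (fundamental-WF wσ γ g) d
    fundamental (t-sub d)      γ g = t-sub (proj₁ (fundamental d γ g))
    fundamental (t-plus d d')  γ g = CompIdx-plus (fundamental d γ g) (fundamental d' γ g)
    fundamental (t-times d d') γ g = CompIdx-times (fundamental d γ g) (fundamental d' γ g)
    fundamental (t-size d)     γ g = CompIdx-size (proj₁ r) (proj₂ r) where r = fundamental d γ g
    fundamental d@(t-seq {E = E} dE) γ g =
      Red-const (circ E ∷ circ E ∷ []) γ g y-circ (fundamental dE γ g) d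
    fundamental d@(t-reverse {E = E} dE) γ g =
      Red-const (circ E ∷ []) γ g y-circ (fundamental dE γ g) d
    fundamental d@(t-dMeas {E = E} _) γ g =
      Red-const (nat ∷ circ E ∷ []) γ g y-nat tt d
    fundamental d@(t-par {E₀ = E₀} {E₁} d₀ d₁) γ g =
      Red-const (circ E₀ ∷ circ E₁ ∷ []) γ g y-circ
        (CompIdx-plus (CompIdx-plus (fundamental d₀ γ g) (fundamental d₁ γ g)) (CompIdx-num 1)) d
    fundamental (t-iter {E₀ = E₀} {E₁} d₀ d₁) γ g =
      Red-retype (sym (subTy-iterTy γ E₀ E₁)) (Red-iter (fundamental d₀ γ g) (fundamental d₁ γ g))
    fundamental (t-conv d e w) γ g =
      Red₀-cast refl (shape-≅ e') refl (Red₀-conv (fundamental d γ g) e' (WFTy-sub (RedSub-⇛ g) w))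
      where e' = subTy-≅ γ e

    CompIdx-closed : ∀ {E} → [] ⊢ E ∶ idx → CompIdx E
    CompIdx-closed {E} d = subst CompIdx (sub-id (λ ()) E) (fundamental d (λ ()) (λ ()))

    Comp₀-typed : ∀ {s σ M} → Comp₀ s M σ → [] ⊢ M ∶ σ
    Comp₀-typed {σ = nat}               d       = d
    Comp₀-typed {σ = idx}               (d , _) = d
    Comp₀-typed {σ = circ E}            (d , _) = d
    Comp₀-typed {sarr _ _} {σ = pi μ τ} (d , _) = d

    sarr-injectiveʳ : ∀ {s t s' t'} → sarr s t ≡ sarr s' t' → t ≡ t'
    sarr-injectiveʳ refl = refl

    Comp₀-closed : ∀ {s σ M} → s ≡ shape σ → [] ⊢ M ∶ σ → Comp₀ s M σ
    Comp₀-closed {σ = nat}    _ d = d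
    Comp₀-closed {σ = idx}    _ d = CompIdx-closed d
    Comp₀-closed {σ = circ E} _ d with ⊢-WFTy d
    ... | wf-circ dE = d , CompIdx-closed dE
    Comp₀-closed {sarr _ _} {pi μ τ} e d = d , λ N c →
      Comp₀-closed (trans (sarr-injectiveʳ e) (sym (shape-[] τ N))) (t-app d (Comp₀-typed c))
    Comp₀-closed {snat}  {pi _ _} () _
    Comp₀-closed {sidx}  {pi _ _} () _
    Comp₀-closed {scirc} {pi _ _} () _

    botSub-typed : ∀ n (Γ : Ctx (suc n)) {N} → WFCtx Γ → [] ⊢ N ∶ bottom Γ →
                   WFCtx (substBot N Γ) ×
                   (∀ i → substBot N Γ ⊢ botSub n N i ∶ subTy (botSub n N) (lookupTy Γ i))
    botSub-typed zero ([] ▸ ν) {N} _ dN =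
      wf-[] , λ { zero → retype (sym closed-wkTy) dN }
      where
      closed-wkTy : subTy (botSub 0 N) (wkTy ν) ≡ ν
      closed-wkTy = trans (subTy-wkTy {t = var} (λ ()) ν) (subTy-id (λ _ → refl) ν)
    botSub-typed (suc n) (Γ ▸ σ) {N} (wf-, w wσ) dN with botSub-typed n Γ w dN
    ... | wΔ , ds = wf-, wΔ wσ' , λ
      { zero    → retype (sym (subTy-wkTy-comm (λ _ → refl) σ)) (t-var (wf-, wΔ wσ'))
      ; (suc i) → retype (sym (subTy-wkTy-comm (λ _ → refl) (lookupTy Γ i))) (⊢-wk wσ' (ds i)) }
      where wσ' = WFTy-sub (base (botSub n N) wΔ ds) wσ

    botSub-⇛ : ∀ n (Γ : Ctx (suc n)) {N} → WFCtx Γ → [] ⊢ N ∶ bottom Γ → Γ ⇛ substBot N Γ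
    botSub-⇛ n Γ {N} w dN = base (botSub n N) (proj₁ typed) (proj₂ typed)
      where typed = botSub-typed n Γ w dN

    comp : ∀ {n} (B : Ctx n) (M : Tm n) (κ : Ty n) → B ⊢ M ∶ κ → Comp B M κ
    comp {zero}  [] M κ d = Comp₀-closed refl d
    comp {suc n} B  M κ d = d , λ N c →
      comp (substBot N B) _ _ (⊢-sub (botSub-⇛ n B (⊢-ctx d) (Comp₀-typed c)) d)

theorem1 : (Gate : ℕ → Set) (‡ : ∀ {k} → Gate k → Gate k)
           (P : CommutativeMonoid 0ℓ 0ℓ)
           (circuitEval : ℕ → ℕ → qPCF.Circuit Gate ‡ P → ℕ → CommutativeMonoid.Carrier P → Set) →
           let open qPCF Gate ‡ P
               open Eval circuitEval
           in ∀ {n} (B : Ctx n) (M : Tm n) (κ : Ty n) → B ⊢ M ∶ κ → Comp B M κ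
theorem1 Gate ‡ P circuitEval = Metatheory.Computability.comp Gate ‡ P circuitEval
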